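{- There are infinitely many (pairwise non-isomorphic) finite simple biconnected outerplanar graphs $G$ with maximum degree $\Delta = 5$ such that $\chi(G^2) = 7$.
   Context: $G^2$ is the graph on $V(G)$ in which two distinct vertices are adjacent iff their distance in $G$ is 1 or 2; $\chi$ is the chromatic number. -}

module Defs where

open import Data.Nat using (ℕ; _≤_; _<_)
open import Data.Fin using (Fin; toℕ)
open import Data.Bool using (Bool; T; true; false)
open import Data.List using (List; length; filterᵇ)
open import Data.List using () renaming (allFin to listAllFin)
open import Data.Product using (Σ; ∃; _×_)
open import Data.Sum using (_⊎_)
open import Data.Unit using (⊤)
open import Relation.Nullary using (¬_)
open import Relation.Binary.PropositionalEquality using (_≡_; _≢_)
open import Function.Definitions using (Injective)

record Graph : Set where
  field
    n     : ℕ
    adj   : Fin n → Fin n → Bool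
    sym   : ∀ u v → adj u v ≡ adj v u
    irrefl : ∀ v → adj v v ≡ false
open Graph public

Adj : (G : Graph) → Fin (n G) → Fin (n G) → Set
Adj G u v = T (adj G u v)

record Iso (G H : Graph) : Set where
  field
    to      : Fin (n G) → Fin (n H)
    from    : Fin (n H) → Fin (n G)
    from-to : ∀ v → from (to v) ≡ v
    to-from : ∀ w → to (from w) ≡ w
    pres    : ∀ u v → adj H (to u) (to v) ≡ adj G u v

degree : (G : Graph) → Fin (n G) → ℕ
degree G v = length (filterᵇ (adj G v) (listAllFin (n G)))

MaxDegree : Graph → ℕ → Set
MaxDegree G d = (∀ v → degree G v ≤ d) × (∃ λ v → degree G v ≡ d)

data Reach (G : Graph) (P : Fin (n G) → Set) : Fin (n G) → Fin (n G) → Set where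
  here : ∀ {u} → P u → Reach G P u u
  step : ∀ {u w v} → P u → Adj G u w → Reach G P w v → Reach G P u v

Connected : Graph → Set
Connected G = ∀ u v → Reach G (λ _ → ⊤) u v

Biconnected : Graph → Set
Biconnected G =
  (3 ≤ n G) × Connected G ×
  (∀ x u v → u ≢ x → v ≢ x → Reach G (λ w → w ≢ x) u v)

-- Outerplanar: the vertices can be placed (in the order given by an injective
-- position map) on a circle so that no two edges, drawn as chords, cross.
-- Chords {a,b} and {c,d} cross iff (after naming) pos a < pos c < pos b < pos d.
Outerplanar : Graph → Set
Outerplanar G =
  Σ (Fin (n G) → Fin (n G)) λ pos →
    Injective _≡_ _≡_ pos ×
    (∀ a b c d → Adj G a b → Adj G c d →
      ¬ ((toℕ (pos a) < toℕ (pos c)) × (toℕ (pos c) < toℕ (pos b)) × (toℕ (pos b) < toℕ (pos d))))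

SqAdj : (G : Graph) → Fin (n G) → Fin (n G) → Set
SqAdj G u v = u ≢ v × (Adj G u v ⊎ (∃ λ w → Adj G u w × Adj G w v))

SqColorable : Graph → ℕ → Set
SqColorable G k = Σ (Fin (n G) → Fin k) λ c → ∀ u v → SqAdj G u v → c u ≢ c v

SqChromaticNumber : Graph → ℕ → Set
SqChromaticNumber G k = SqColorable G k × (∀ j → j < k → ¬ SqColorable G j)

-- The graphs are cycles 0, 1, …, 12 + 3i with six fixed, pairwise non-crossing chords among the
-- vertices 1, …, 10: hence biconnected and outerplanar, of maximum degree 5, and told apart by
-- their orders.  In the square, 3, 7 and 9 are adjacent to each other and to 1, 2, 4, 5, 6, 8, 10,
-- whose square contains two diamonds (pairs of triangles sharing an edge).  In a 3-colouring the
-- tips of a diamond agree, which forces 2, 4 and 8 to share a colour although 2 and 4 are adjacent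
-- in the square; so at least 3 + 4 colours are needed.  Seven suffice: colour the long path
-- 11, …, 12 + 3i periodically with three colours.

module Submission where

open import Defs
open import Data.Nat using (ℕ; zero; suc; pred; _+_; _*_; _∸_; _≤_; _<_; z≤n; s≤s; s≤s⁻¹; _≡ᵇ_; _≟_; _≤?_; _<?_)
open import Data.Nat.Properties
  using ( module ≤-Reasoning; ≡ᵇ⇒≡; ≡⇒≡ᵇ; ≤-refl; ≤-reflexive; ≤-trans; ≤-total; <-trans; <-≤-trans; ≤-<-trans; <⇒≤; <⇒≱; <⇒≢; n≤1+n
        ; m≤n+m; m≤m+n; m≤n⇒m≤1+n; +-suc; +-mono-≤; +-monoʳ-≤; m∸n+n≡m; <-cmp; ≮⇒≥; m≤n⇒∃[o]m+o≡n
        ; +-cancelˡ-≡; *-cancelʳ-≡; suc-injective; allUpTo?; anyUpTo? )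
open import Data.Fin using (Fin; zero; suc; toℕ; fromℕ<; inject≤; punchOut; #_)
open import Data.Fin.Properties
  using (toℕ-injective; toℕ<n; toℕ-fromℕ<; inject≤-injective; punchOut-injective; cantor-schröder-bernstein)
  renaming (_≟_ to _≟ᶠ_; all? to allFin?)
open import Data.Bool using (Bool; true; false; T; not; _∧_; _∨_; if_then_else_)
open import Data.Bool.Properties using (T?; T-∧; T-∨; ∨-comm)
open import Data.Bool.ListAction using (any)
open import Data.List using (List; []; _∷_; _++_; map; length; filterᵇ; tabulate)
open import Data.List.Membership.Propositional using (_∈_)
open import Data.List.Membership.Propositional.Properties using (∈-map⁺; ∈-++⁺ˡ; ∈-++⁺ʳ; ∈-filter⁺)
open import Data.List.Relation.Unary.All as All using (All)
open import Data.List.Relation.Unary.Any using (here; there)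
open import Data.Vec using (lookup) renaming ([] to []ᵛ; _∷_ to _∷ᵛ_)
open import Data.Product using (Σ; ∃; _×_; _,_; proj₁; proj₂; swap)
open import Data.Sum as Sum using (_⊎_; inj₁; inj₂; [_,_])
open import Data.Unit using (tt)
open import Data.Empty using (⊥-elim)
open import Function using (_∘_; id; Equivalence)
open import Relation.Nullary using (¬_; Dec; yes; no; ¬?)
open import Relation.Nullary.Decidable using (toWitness; _×-dec_; _⊎-dec_; _→-dec_)
open import Relation.Binary using (tri<; tri≈; tri>)
open import Relation.Binary.PropositionalEquality as ≡ using (_≡_; _≢_; refl; cong; cong₂; subst; ≢-sym)

Colourable : {V : Set} → (V → V → Set) → ℕ → Set
Colourable {V} R k = Σ (V → Fin k) λ c → ∀ u v → R u v → c u ≢ c v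

colourable-comap : {V W : Set} {R : V → V → Set} {E : W → W → Set} {k : ℕ} (f : W → V) →
                   (∀ u v → E u v → R (f u) (f v)) → Colourable R k → Colourable E k
colourable-comap f hom (c , proper) = c ∘ f , λ u v e → proper (f u) (f v) (hom u v e)

colourable-mono : {V : Set} {R : V → V → Set} {j k : ℕ} → j ≤ k → Colourable R j → Colourable R k
colourable-mono j≤k (c , proper) =
  (λ v → inject≤ (c v) j≤k) , λ u v e eq → proper u v e (inject≤-injective j≤k j≤k _ _ eq)

Cone : {m : ℕ} → (Fin m → Fin m → Bool) → Fin (suc m) → Fin (suc m) → Bool
Cone E zero    zero    = false
Cone E zero    (suc _) = true
Cone E (suc _) zero    = true
Cone E (suc u) (suc v) = E u v

colourable-uncone : {m k : ℕ} {E : Fin m → Fin m → Bool} →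
                    Colourable (λ u v → T (Cone E u v)) (suc k) → Colourable (λ u v → T (E u v)) k
colourable-uncone (c , proper) =
  (λ v → punchOut (apex≢ v)) ,
  λ u v e eq → proper (suc u) (suc v) e (punchOut-injective (apex≢ u) (apex≢ v) eq)
  where
  apex≢ : ∀ v → c zero ≢ c (suc v)
  apex≢ v = proper zero (suc v) tt

diamond-tips-agree : (x y z w : Fin 3) → x ≢ y → x ≢ z → y ≢ z → y ≢ w → z ≢ w → x ≡ w
diamond-tips-agree = toWitness {a? = allFin? λ x → allFin? λ y → allFin? λ z → allFin? λ w →
  ¬? (x ≟ᶠ y) →-dec ¬? (x ≟ᶠ z) →-dec ¬? (y ≟ᶠ z) →-dec ¬? (y ≟ᶠ w) →-dec ¬? (z ≟ᶠ w) →-dec x ≟ᶠ w} _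

≡ᵇ-sym : ∀ a b → (a ≡ᵇ b) ≡ (b ≡ᵇ a)
≡ᵇ-sym zero    zero    = refl
≡ᵇ-sym zero    (suc b) = refl
≡ᵇ-sym (suc a) zero    = refl
≡ᵇ-sym (suc a) (suc b) = ≡ᵇ-sym a b

≡ᵇ-refl : ∀ a → (a ≡ᵇ a) ≡ true
≡ᵇ-refl zero    = refl
≡ᵇ-refl (suc a) = ≡ᵇ-refl a

≢⇒not-≡ᵇ : ∀ {a b} → a ≢ b → T (not (a ≡ᵇ b))
≢⇒not-≡ᵇ {a} {b} a≢b with a ≡ᵇ b in eq
... | true  = ⊥-elim (a≢b (≡ᵇ⇒≡ a b (subst T (≡.sym eq) tt)))
... | false = tt

listedᵇ : List (ℕ × ℕ) → ℕ → ℕ → Bool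
listedᵇ es a b = any (λ (x , y) → (x ≡ᵇ a) ∧ (y ≡ᵇ b)) es

linkedᵇ : List (ℕ × ℕ) → ℕ → ℕ → Bool
linkedᵇ es a b = listedᵇ es a b ∨ listedᵇ es b a

listed⇒∈ : ∀ es {a b} → T (listedᵇ es a b) → (a , b) ∈ es
listed⇒∈ ((x , y) ∷ es) {a} {b} l with Equivalence.to T-∨ l
... | inj₂ l′ = there (listed⇒∈ es l′)
... | inj₁ xy with Equivalence.to T-∧ xy
...   | x≡a , y≡b = here (cong₂ _,_ (≡.sym (≡ᵇ⇒≡ x a x≡a)) (≡.sym (≡ᵇ⇒≡ y b y≡b)))

linked-sym : ∀ es {a b} → T (linkedᵇ es a b) → T (linkedᵇ es b a)
linked-sym es {a} {b} = subst T (∨-comm (listedᵇ es a b) (listedᵇ es b a))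

linked-endpoints : ∀ {P : ℕ → Set} es {a b} → All (λ (x , y) → P x × P y) es → T (linkedᵇ es a b) → P a × P b
linked-endpoints es ps l with Equivalence.to T-∨ l
... | inj₁ ab = All.lookup ps (listed⇒∈ es ab)
... | inj₂ ba = swap (All.lookup ps (listed⇒∈ es ba))

oriented : List (ℕ × ℕ) → List (ℕ × ℕ)
oriented es = es ++ map swap es

linked⇒oriented : ∀ es {a b} → T (linkedᵇ es a b) → (a , b) ∈ oriented es
linked⇒oriented es l =
  [ ∈-++⁺ˡ ∘ listed⇒∈ es , ∈-++⁺ʳ es ∘ ∈-map⁺ swap ∘ listed⇒∈ es ] (Equivalence.to T-∨ l)

partners : List (ℕ × ℕ) → ℕ → List ℕ
partners es a = map proj₂ (filterᵇ (λ (x , _) → x ≡ᵇ a) (oriented es))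

linked⇒partner : ∀ es {a b} → T (linkedᵇ es a b) → b ∈ partners es a
linked⇒partner es {a} l =
  ∈-map⁺ proj₂ (∈-filter⁺ (λ (x , _) → T? (x ≡ᵇ a)) (linked⇒oriented es l) (≡⇒≡ᵇ a a refl))

count : {m : ℕ} → (Fin m → Bool) → ℕ
count {zero}  p = 0
count {suc m} p = (if p zero then 1 else 0) + count (p ∘ suc)

length-filterᵇ-tabulate : {A : Set} {m : ℕ} (p : A → Bool) (f : Fin m → A) →
                          length (filterᵇ p (tabulate f)) ≡ count (p ∘ f)
length-filterᵇ-tabulate {m = zero}  p f = refl
length-filterᵇ-tabulate {m = suc m} p f with p (f zero)
... | true  = cong suc (length-filterᵇ-tabulate p (f ∘ suc))
... | false = length-filterᵇ-tabulate p (f ∘ suc)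

count-none : {m : ℕ} {p : Fin m → Bool} → (∀ x → ¬ T (p x)) → count p ≡ 0
count-none {zero}          none = refl
count-none {suc m} {p} none with p zero | none zero
... | true  | ¬t = ⊥-elim (¬t tt)
... | false | _  = count-none (none ∘ suc)

count-mono : {m : ℕ} {p q : Fin m → Bool} → (∀ x → T (p x) → T (q x)) → count p ≤ count q
count-mono {zero}          p⇒q = z≤n
count-mono {suc m} {p} {q} p⇒q with p zero | q zero | p⇒q zero
... | true  | true  | _   = s≤s (count-mono (p⇒q ∘ suc))
... | true  | false | t⇒f = ⊥-elim (t⇒f tt)
... | false | true  | _   = m≤n⇒m≤1+n (count-mono (p⇒q ∘ suc))
... | false | false | _   = count-mono (p⇒q ∘ suc)

count-∨ : {m : ℕ} (p q : Fin m → Bool) → count (λ x → p x ∨ q x) ≤ count p + count q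
count-∨ {zero}  p q = z≤n
count-∨ {suc m} p q with p zero | q zero | count-∨ (p ∘ suc) (q ∘ suc)
... | true  | b     | ih = s≤s (≤-trans ih (+-monoʳ-≤ (count (p ∘ suc)) (m≤n+m _ (if b then 1 else 0))))
... | false | true  | ih = ≤-trans (s≤s ih) (≤-reflexive (≡.sym (+-suc _ _)))
... | false | false | ih = ih

count-≡ᵇ : {m : ℕ} (t : ℕ) → count {m} (λ x → toℕ x ≡ᵇ t) ≤ 1
count-≡ᵇ {zero}  t       = z≤n
count-≡ᵇ {suc m} zero    = s≤s (≤-reflexive (count-none {m} λ _ ()))
count-≡ᵇ {suc m} (suc t) = count-≡ᵇ {m} t

count-any : {m : ℕ} (L : List ℕ) → count {m} (λ x → any (toℕ x ≡ᵇ_) L) ≤ length L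
count-any {m} []      = ≤-reflexive (count-none {m} λ _ ())
count-any {m} (t ∷ L) = ≤-trans (count-∨ {m} _ _) (+-mono-≤ (count-≡ᵇ {m} t) (count-any {m} L))

∈⇒any : ∀ {t} L → t ∈ L → T (any (t ≡ᵇ_) L)
∈⇒any {t} (_ ∷ _) (here refl) = Equivalence.from T-∨ (inj₁ (≡⇒≡ᵇ t t refl))
∈⇒any     (_ ∷ L) (there t∈L) = Equivalence.from T-∨ (inj₂ (∈⇒any L t∈L))

degree-≤-candidates : (G : Graph) (v : Fin (n G)) (L : List ℕ) →
                      (∀ w → Adj G v w → toℕ w ∈ L) → degree G v ≤ length L
degree-≤-candidates G v L candidate = begin
  degree G v                            ≡⟨ length-filterᵇ-tabulate (adj G v) id ⟩
  count (adj G v)                       ≤⟨ count-mono (λ w a → ∈⇒any L (candidate w a)) ⟩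
  count {n G} (λ w → any (toℕ w ≡ᵇ_) L) ≤⟨ count-any {n G} L ⟩
  length L                              ∎
  where open ≤-Reasoning

module _ {G : Graph} {P : Fin (n G) → Set} where

  reach-start : ∀ {u v} → Reach G P u v → P u
  reach-start (here p)     = p
  reach-start (step p _ _) = p

  reach-trans : ∀ {u v w} → Reach G P u v → Reach G P v w → Reach G P u w
  reach-trans (here _)     r′ = r′
  reach-trans (step p a r) r′ = step p a (reach-trans r r′)

  reach-sym : ∀ {u v} → Reach G P u v → Reach G P v u
  reach-sym (here p)             = here p
  reach-sym (step {u} {w} p a r) =
    reach-trans (reach-sym r) (step (reach-start r) (subst T (sym G u w) a) (here p))

  ascend : (∀ u v → suc (toℕ u) ≡ toℕ v → Adj G u v) →
           ∀ u v → toℕ u ≤ toℕ v → (∀ w → toℕ u ≤ toℕ w → toℕ w ≤ toℕ v → P w) → Reach G P u v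
  ascend consecutive u v u≤v = climb (toℕ v ∸ toℕ u) u (≡.sym (m∸n+n≡m u≤v))
    where
    climb : ∀ d u → toℕ v ≡ d + toℕ u → (∀ w → toℕ u ≤ toℕ w → toℕ w ≤ toℕ v → P w) → Reach G P u v
    climb zero u v≡u p with toℕ-injective v≡u
    ... | refl = here (p u ≤-refl ≤-refl)
    climb (suc d) u v≡1+d+u p =
      step (p u ≤-refl (<⇒≤ u<v)) (consecutive u u⁺ (≡.sym (toℕ-fromℕ< u⁺<n)))
           (climb d u⁺ v≡d+u⁺ λ w u⁺≤w → p w (≤-trans (n≤1+n _) (subst (_≤ toℕ w) (toℕ-fromℕ< u⁺<n) u⁺≤w)))
      where
      u<v : toℕ u < toℕ v
      u<v = ≤-trans (s≤s (m≤n+m (toℕ u) d)) (≤-reflexive (≡.sym v≡1+d+u))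
      u⁺<n : suc (toℕ u) < n G
      u⁺<n = ≤-<-trans u<v (toℕ<n v)
      u⁺ : Fin (n G)
      u⁺ = fromℕ< u⁺<n
      v≡d+u⁺ : toℕ v ≡ d + toℕ u⁺
      v≡d+u⁺ = ≡.trans v≡1+d+u (≡.trans (≡.sym (+-suc d (toℕ u))) (cong (d +_) (≡.sym (toℕ-fromℕ< u⁺<n))))

record LabelCycle (G : Graph) : Set where
  field
    consecutive : ∀ u v → suc (toℕ u) ≡ toℕ v → Adj G u v
    closing     : ∀ u v → toℕ u ≡ 0 → suc (toℕ v) ≡ n G → Adj G u v

label-cycle⇒biconnected : (G : Graph) → 3 ≤ n G → LabelCycle G → Biconnected G
label-cycle⇒biconnected G 3≤n cycle = 3≤n , connected , avoid
  where
  open LabelCycle cycle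

  connected : Connected G
  connected u v with ≤-total (toℕ u) (toℕ v)
  ... | inj₁ u≤v = ascend consecutive u v u≤v (λ _ _ _ → tt)
  ... | inj₂ v≤u = reach-sym (ascend consecutive v u v≤u (λ _ _ _ → tt))

  apart : ∀ {w x : Fin (n G)} → toℕ w ≢ toℕ x → w ≢ x
  apart w≢x = w≢x ∘ cong toℕ

  o : ℕ
  o = proj₁ (m≤n⇒∃[o]m+o≡n 3≤n)

  3+o≡n : 3 + o ≡ n G
  3+o≡n = proj₂ (m≤n⇒∃[o]m+o≡n 3≤n)

  first last : Fin (n G)
  first = fromℕ< (≤-trans (s≤s z≤n) 3≤n)
  last  = fromℕ< (≤-reflexive 3+o≡n)

  first≤ : ∀ w → toℕ first ≤ toℕ w
  first≤ w = subst (_≤ toℕ w) (≡.sym (toℕ-fromℕ< _)) z≤n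

  ≤last : ∀ w → toℕ w ≤ toℕ last
  ≤last w = subst (toℕ w ≤_) (≡.sym (toℕ-fromℕ< _)) (s≤s⁻¹ (subst (toℕ w <_) (≡.sym 3+o≡n) (toℕ<n w)))

  avoid-ordered : ∀ x u v → toℕ u ≤ toℕ v → u ≢ x → v ≢ x → Reach G (_≢ x) u v
  avoid-ordered x u v u≤v u≢x v≢x with <-cmp (toℕ x) (toℕ u) | <-cmp (toℕ x) (toℕ v)
  ... | tri< x<u _ _ | _ =
    ascend consecutive u v u≤v λ w u≤w _ → apart (≢-sym (<⇒≢ (<-≤-trans x<u u≤w)))
  ... | tri≈ _ x≡u _ | _ = ⊥-elim (u≢x (toℕ-injective (≡.sym x≡u)))
  ... | tri> _ _ _ | tri≈ _ x≡v _ = ⊥-elim (v≢x (toℕ-injective (≡.sym x≡v)))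
  ... | tri> _ _ _ | tri> _ _ v<x =
    ascend consecutive u v u≤v λ w _ w≤v → apart (<⇒≢ (≤-<-trans w≤v v<x))
  ... | tri> _ _ u<x | tri< x<v _ _ =
    -- descend from u to first, take the closing edge to last, descend from last to v
    reach-trans (reach-sym (ascend consecutive first u (first≤ u) λ w _ w≤u → apart (<⇒≢ (≤-<-trans w≤u u<x))))
      (step (apart (<⇒≢ (≤-<-trans (first≤ u) u<x))) (closing first last (toℕ-fromℕ< _) (≡.trans (cong suc (toℕ-fromℕ< _)) 3+o≡n))
        (reach-sym (ascend consecutive v last (≤last v) λ w v≤w _ → apart (≢-sym (<⇒≢ (<-≤-trans x<v v≤w))))))

  avoid : ∀ x u v → u ≢ x → v ≢ x → Reach G (_≢ x) u v
  avoid x u v u≢x v≢x with ≤-total (toℕ u) (toℕ v)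
  ... | inj₁ u≤v = avoid-ordered x u v u≤v u≢x v≢x
  ... | inj₂ v≤u = reach-sym (avoid-ordered x v u v≤u v≢x u≢x)

iso⇒same-order : {G H : Graph} → Iso G H → n G ≡ n H
iso⇒same-order iso = cantor-schröder-bernstein to-injective from-injective
  where
  open Iso iso
  to-injective : ∀ {u v} → to u ≡ to v → u ≡ v
  to-injective {u} {v} eq = ≡.trans (≡.sym (from-to u)) (≡.trans (cong from eq) (from-to v))
  from-injective : ∀ {u v} → from u ≡ from v → u ≡ v
  from-injective {u} {v} eq = ≡.trans (≡.sym (to-from u)) (≡.trans (cong to eq) (to-from v))

-- Polygons: the cycle 0, 1, …, M−1 together with chords

stepᵇ : ℕ → ℕ → ℕ → Bool
stepᵇ M a b = (suc a ≡ᵇ b) ∨ ((b ≡ᵇ 0) ∧ (suc a ≡ᵇ M))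

-- The conjunct not (a ≡ᵇ b) keeps the graph loopless for every M and every chord list.
polygonᵇ : ℕ → List (ℕ × ℕ) → ℕ → ℕ → Bool
polygonᵇ M cs a b = not (a ≡ᵇ b) ∧ ((stepᵇ M a b ∨ stepᵇ M b a) ∨ linkedᵇ cs a b)

polygon : ℕ → List (ℕ × ℕ) → Graph
polygon M cs = record
  { n      = M
  ; adj    = λ u v → polygonᵇ M cs (toℕ u) (toℕ v)
  ; sym    = λ u v → symmetric (toℕ u) (toℕ v)
  ; irrefl = λ v → irreflexive (toℕ v)
  }
  where
  irreflexive : ∀ a → polygonᵇ M cs a a ≡ false
  irreflexive a rewrite ≡ᵇ-refl a = refl

  symmetric : ∀ a b → polygonᵇ M cs a b ≡ polygonᵇ M cs b a
  symmetric a b = cong₂ _∧_ (cong not (≡ᵇ-sym a b))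
    (cong₂ _∨_ (∨-comm (stepᵇ M a b) (stepᵇ M b a)) (∨-comm (listedᵇ cs a b) (listedᵇ cs b a)))

data Step (M : ℕ) : ℕ → ℕ → Set where
  next : ∀ {a} → Step M a (suc a)
  wrap : ∀ {a} → suc a ≡ M → Step M a 0

stepᵇ⇒Step : ∀ {M a b} → T (stepᵇ M a b) → Step M a b
stepᵇ⇒Step {M} {a} {b} s with Equivalence.to T-∨ s
... | inj₁ 1+a≡b = subst (Step M a) (≡ᵇ⇒≡ (suc a) b 1+a≡b) next
... | inj₂ wrapped with Equivalence.to T-∧ wrapped
...   | b≡0 , 1+a≡M = subst (Step M a) (≡.sym (≡ᵇ⇒≡ b 0 b≡0)) (wrap (≡ᵇ⇒≡ (suc a) M 1+a≡M))

Step⇒stepᵇ : ∀ {M a b} → Step M a b → T (stepᵇ M a b)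
Step⇒stepᵇ {a = a} next    = Equivalence.from T-∨ (inj₁ (≡⇒≡ᵇ (suc a) (suc a) refl))
Step⇒stepᵇ {a = a} (wrap e) = ≡⇒≡ᵇ (suc a) _ e

data PolygonEdge (M : ℕ) (cs : List (ℕ × ℕ)) (a b : ℕ) : Set where
  forward  : Step M a b → PolygonEdge M cs a b
  backward : Step M b a → PolygonEdge M cs a b
  chord    : T (linkedᵇ cs a b) → PolygonEdge M cs a b

polygon-edge : ∀ {M cs a b} → T (polygonᵇ M cs a b) → PolygonEdge M cs a b
polygon-edge e with Equivalence.to T-∨ (proj₂ (Equivalence.to T-∧ e))
... | inj₂ c = chord c
... | inj₁ s with Equivalence.to T-∨ s
...   | inj₁ ab = forward (stepᵇ⇒Step ab)
...   | inj₂ ba = backward (stepᵇ⇒Step ba)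

polygon-edge-sym : ∀ {M cs a b} → PolygonEdge M cs a b → PolygonEdge M cs b a
polygon-edge-sym (forward s)  = backward s
polygon-edge-sym (backward s) = forward s
polygon-edge-sym {cs = cs} (chord c) = chord (linked-sym cs c)

step-injective : ∀ {M a b w} → Step M a w → Step M b w → a ≡ b
step-injective next     next      = refl
step-injective (wrap e) (wrap e′) = suc-injective (≡.trans e (≡.sym e′))

step-functional : ∀ {M a b w} → a < M → b < M → Step M w a → Step M w b → a ≡ b
step-functional _   _   next     next     = refl
step-functional _   _   (wrap _) (wrap _) = refl
step-functional a<M _   next     (wrap e) = ⊥-elim (<⇒≢ a<M e)
step-functional _   b<M (wrap e) next     = ⊥-elim (<⇒≢ b<M e)

step⇒polygonᵇ : ∀ {M cs a b} → a ≢ b → Step M a b ⊎ Step M b a → T (polygonᵇ M cs a b)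
step⇒polygonᵇ {M} {cs} {a} {b} a≢b s =
  Equivalence.from T-∧ (≢⇒not-≡ᵇ a≢b , Equivalence.from (T-∨ {y = linkedᵇ cs a b}) (inj₁ cyclic))
  where
  cyclic : T (stepᵇ M a b ∨ stepᵇ M b a)
  cyclic = Equivalence.from T-∨ (Sum.map Step⇒stepᵇ Step⇒stepᵇ s)

polygon-label-cycle : ∀ {M cs} → 2 ≤ M → LabelCycle (polygon M cs)
polygon-label-cycle {M} {cs} 2≤M = record
  { consecutive = λ u v 1+u≡v →
      step⇒polygonᵇ {M} {cs} (<⇒≢ (≤-reflexive 1+u≡v)) (inj₁ (subst (Step M (toℕ u)) 1+u≡v next))
  ; closing = λ u v u≡0 1+v≡M →
      step⇒polygonᵇ {M} {cs} (u≢v u≡0 1+v≡M) (inj₂ (subst (Step M (toℕ v)) (≡.sym u≡0) (wrap 1+v≡M)))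
  }
  where
  u≢v : ∀ {a b} → a ≡ 0 → suc b ≡ M → a ≢ b
  u≢v refl 1+b≡M refl with subst (2 ≤_) (≡.sym 1+b≡M) 2≤M
  ... | s≤s ()

Crossing : ℕ → ℕ → ℕ → ℕ → Set
Crossing a b c d = a < c × c < b × b < d

NonCrossing : List (ℕ × ℕ) → Set
NonCrossing cs = ∀ {a b c d} → T (linkedᵇ cs a b) → T (linkedᵇ cs c d) → ¬ Crossing a b c d

pairwise-uncrossed⇒NonCrossing : ∀ es →
  All (λ (a , b) → All (λ (c , d) → ¬ Crossing a b c d) (oriented es)) (oriented es) → NonCrossing es
pairwise-uncrossed⇒NonCrossing es uncrossed ab cd =
  All.lookup (All.lookup uncrossed (linked⇒oriented es ab)) (linked⇒oriented es cd)

-- Nothing lies strictly between the ends of a cycle edge, so only chords can cross chords.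
polygon-edges-uncrossed : ∀ {M cs a b c d} → d < M → NonCrossing cs →
                          PolygonEdge M cs a b → PolygonEdge M cs c d → ¬ Crossing a b c d
polygon-edges-uncrossed _ _ (forward next) _ (a<c , c<1+a , _) = <⇒≱ a<c (s≤s⁻¹ c<1+a)
polygon-edges-uncrossed _ _ (forward (wrap _)) _ (_ , () , _)
polygon-edges-uncrossed {b = b} _ _ (backward next) _ (1+b<c , c<b , _) = <⇒≱ (<-trans 1+b<c c<b) (n≤1+n b)
polygon-edges-uncrossed d<M _ (backward (wrap 1+b≡M)) _ (_ , _ , b<d) =
  <⇒≱ b<d (s≤s⁻¹ (subst (_ <_) (≡.sym 1+b≡M) d<M))
polygon-edges-uncrossed _ _ (chord _) (forward next) (_ , c<b , b<1+c) = <⇒≱ c<b (s≤s⁻¹ b<1+c)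
polygon-edges-uncrossed _ _ (chord _) (forward (wrap _)) (_ , _ , ())
polygon-edges-uncrossed {d = d} _ _ (chord _) (backward next) (_ , c<b , b<d) = <⇒≱ (<-trans c<b b<d) (n≤1+n d)
polygon-edges-uncrossed _ _ (chord _) (backward (wrap _)) (() , _ , _)
polygon-edges-uncrossed _ non-crossing (chord ab) (chord cd) = non-crossing ab cd

polygon-outerplanar : ∀ {M cs} → NonCrossing cs → Outerplanar (polygon M cs)
polygon-outerplanar {M} {cs} non-crossing = id , id , λ a b c d ab cd →
  polygon-edges-uncrossed (toℕ<n d) non-crossing (polygon-edge {M} {cs} ab) (polygon-edge {M} {cs} cd)

after : ℕ → ℕ → ℕ
after M a = if suc a ≡ᵇ M then 0 else suc a

before : ℕ → ℕ → ℕ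
before M zero    = pred M
before M (suc a) = a

step⇒after : ∀ {M a b} → b < M → Step M a b → b ≡ after M a
step⇒after {M} {a} 1+a<M next with suc a ≡ᵇ M in eq
... | true  = ⊥-elim (<⇒≢ 1+a<M (≡ᵇ⇒≡ (suc a) M (subst T (≡.sym eq) tt)))
... | false = refl
step⇒after {M} {a} _ (wrap 1+a≡M) with suc a ≡ᵇ M in eq
... | true  = refl
... | false = ⊥-elim (subst T eq (≡⇒≡ᵇ (suc a) M 1+a≡M))

step⇒before : ∀ {M a b} → Step M b a → b ≡ before M a
step⇒before next         = refl
step⇒before (wrap 1+b≡M) = cong pred 1+b≡M

polygon-degree : ∀ {M cs} (v : Fin M) → degree (polygon M cs) v ≤ 2 + length (partners cs (toℕ v))
polygon-degree {M} {cs} v = degree-≤-candidates (polygon M cs) v _ candidate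
  where
  candidate : ∀ w → Adj (polygon M cs) v w → toℕ w ∈ after M (toℕ v) ∷ before M (toℕ v) ∷ partners cs (toℕ v)
  candidate w e with polygon-edge {M} {cs} e
  ... | forward s  = here (step⇒after (toℕ<n w) s)
  ... | backward s = there (here (step⇒before s))
  ... | chord c    = there (there (linked⇒partner cs c))

SqAdjBelow : (ℕ → ℕ → Bool) → ℕ → ℕ → ℕ → Set
SqAdjBelow adj h a b = a ≢ b × (T (adj a b) ⊎ ∃ λ w → w < h × T (adj a w) × T (adj w b))

sqAdjBelow? : ∀ adj h a b → Dec (SqAdjBelow adj h a b)
sqAdjBelow? adj h a b =
  ¬? (a ≟ b) ×-dec (T? (adj a b) ⊎-dec anyUpTo? (λ w → T? (adj a w) ×-dec T? (adj w b)) h)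

sqAdjBelow⇒SqAdj : ∀ {M cs h a b} {u v : Fin M} → h ≤ M → toℕ u ≡ a → toℕ v ≡ b →
                   SqAdjBelow (polygonᵇ M cs) h a b → SqAdj (polygon M cs) u v
sqAdjBelow⇒SqAdj _ refl refl (a≢b , inj₁ ab) = a≢b ∘ cong toℕ , inj₁ ab
sqAdjBelow⇒SqAdj {M} {cs} {u = u} {v} h≤M refl refl (a≢b , inj₂ (w , w<h , aw , wb)) =
  a≢b ∘ cong toℕ , inj₂ (fromℕ< w<M ,
    subst (λ x → T (polygonᵇ M cs (toℕ u) x)) (≡.sym (toℕ-fromℕ< w<M)) aw ,
    subst (λ x → T (polygonᵇ M cs x (toℕ v))) (≡.sym (toℕ-fromℕ< w<M)) wb)
  where
  w<M : w < M
  w<M = <-≤-trans w<h h≤M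

below-or-above : ∀ {P : ℕ → Set} h → (∀ {a} → a < h → P a) → (∀ k → P (h + k)) → ∀ a → P a
below-or-above h below above a with a <? h
... | yes a<h = below a<h
... | no  a≮h with m≤n⇒∃[o]m+o≡n (≮⇒≥ a≮h)
...   | k , refl = above k

gadget : List (ℕ × ℕ)
gadget = (1 , 9) ∷ (1 , 10) ∷ (3 , 7) ∷ (3 , 9) ∷ (5 , 7) ∷ (7 , 9) ∷ []

order : ℕ → ℕ
order i = 13 + i * 3

gadgetPolygon : ℕ → Graph
gadgetPolygon i = polygon (order i) gadget

order-injective : ∀ {i j} → order i ≡ order j → i ≡ j
order-injective {i} {j} eq = *-cancelʳ-≡ i j 3 (+-cancelˡ-≡ 13 _ _ eq)

gadget-endpoints : ∀ {a b} → T (linkedᵇ gadget a b) → (1 ≤ a × a ≤ 10) × (1 ≤ b × b ≤ 10)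
gadget-endpoints = linked-endpoints gadget
  (toWitness {a? = All.all? (λ (x , y) → ((1 ≤? x) ×-dec (x ≤? 10)) ×-dec ((1 ≤? y) ×-dec (y ≤? 10))) gadget} _)

gadget-non-crossing : NonCrossing gadget
gadget-non-crossing = pairwise-uncrossed⇒NonCrossing gadget
  (toWitness {a? = All.all? (λ (a , b) → All.all? (λ (c , d) → ¬? ((a <? c) ×-dec (c <? b) ×-dec (b <? d)))
                                                 (oriented gadget)) (oriented gadget)} _)

gadget-partners : ∀ a → length (partners gadget a) ≤ 3
gadget-partners = below-or-above 11 (toWitness {a? = allUpTo? (λ a → length (partners gadget a) ≤? 3) 11} _)
                                    (λ _ → z≤n)

tailColour : ℕ → Fin 7
tailColour 0 = # 1
tailColour 1 = # 2
tailColour 2 = # 4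
tailColour (suc (suc (suc k))) = tailColour k

colour : ℕ → Fin 7
colour 0  = # 4
colour 1  = # 0
colour 2  = # 1
colour 3  = # 2
colour 4  = # 0
colour 5  = # 1
colour 6  = # 3
colour 7  = # 4
colour 8  = # 5
colour 9  = # 6
colour 10 = # 3
colour (suc (suc (suc (suc (suc (suc (suc (suc (suc (suc (suc k))))))))))) = tailColour k

tailColour-next : ∀ k → tailColour k ≢ tailColour (suc k)
tailColour-next 0 = λ ()
tailColour-next 1 = λ ()
tailColour-next 2 = λ ()
tailColour-next (suc (suc (suc k))) = tailColour-next k

tailColour-next² : ∀ k → tailColour k ≢ tailColour (suc (suc k))
tailColour-next² 0 = λ ()
tailColour-next² 1 = λ ()
tailColour-next² 2 = λ ()
tailColour-next² (suc (suc (suc k))) = tailColour-next² k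

colour-next : ∀ a → colour a ≢ colour (suc a)
colour-next = below-or-above 11
  (toWitness {a? = allUpTo? (λ a → ¬? (colour a ≟ᶠ colour (suc a))) 11} _) tailColour-next

colour-next² : ∀ a → colour a ≢ colour (suc (suc a))
colour-next² = below-or-above 11
  (toWitness {a? = allUpTo? (λ a → ¬? (colour a ≟ᶠ colour (suc (suc a)))) 11} _) tailColour-next²

penultimate-colour : ∀ i → tailColour (i * 3) ≡ # 1
penultimate-colour zero    = refl
penultimate-colour (suc i) = penultimate-colour i

last-colour : ∀ i → tailColour (suc (i * 3)) ≡ # 2
last-colour zero    = refl
last-colour (suc i) = last-colour i

twoDiamonds : Fin 7 → Fin 7 → Bool
twoDiamonds u v = linkedᵇ edges (toℕ u) (toℕ v)
  where
  edges : List (ℕ × ℕ)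
  edges = (0 , 1) ∷ (0 , 5) ∷ (0 , 6) ∷ (1 , 2) ∷ (1 , 6) ∷ (2 , 3) ∷ (2 , 4) ∷ (3 , 4) ∷ (3 , 5) ∷ (4 , 5) ∷ (5 , 6) ∷ []

twoDiamonds-not-3-colourable : ¬ Colourable (λ u v → T (twoDiamonds u v)) 3
twoDiamonds-not-3-colourable (c , proper) = proper (# 1) (# 2) tt (≡.trans c₁≡c₅ (≡.sym c₂≡c₅))
  where
  c₁≡c₅ : c (# 1) ≡ c (# 5)
  c₁≡c₅ = diamond-tips-agree (c (# 1)) (c (# 6)) (c (# 0)) (c (# 5))
    (proper _ _ tt) (proper _ _ tt) (proper _ _ tt) (proper _ _ tt) (proper _ _ tt)
  c₂≡c₅ : c (# 2) ≡ c (# 5)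
  c₂≡c₅ = diamond-tips-agree (c (# 2)) (c (# 3)) (c (# 4)) (c (# 5))
    (proper _ _ tt) (proper _ _ tt) (proper _ _ tt) (proper _ _ tt) (proper _ _ tt)

obstruction : Fin 10 → Fin 10 → Bool
obstruction = Cone (Cone (Cone twoDiamonds))

-- The polygon vertex playing the role of each vertex of the obstruction: first the three apexes,
-- then the vertices 0, …, 6 of twoDiamonds.
label : Fin 10 → ℕ
label = lookup (3 ∷ᵛ 7 ∷ᵛ 9 ∷ᵛ 1 ∷ᵛ 2 ∷ᵛ 4 ∷ᵛ 5 ∷ᵛ 6 ∷ᵛ 8 ∷ᵛ 10 ∷ᵛ []ᵛ)

module GadgetPolygon (i : ℕ) where

  M : ℕ
  M = order i

  12≤M : 12 ≤ M
  12≤M = ≤-trans (n≤1+n 12) (m≤m+n 13 (i * 3))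

  step-colour : ∀ {a b} → Step M a b → colour a ≢ colour b
  step-colour {a} next    = colour-next a
  step-colour (wrap refl) rewrite last-colour i = λ ()

  two-step-colour : ∀ {a w b} → Step M a w → Step M w b → colour a ≢ colour b
  two-step-colour {a} next next = colour-next² a
  two-step-colour next (wrap refl) rewrite penultimate-colour i = λ ()
  two-step-colour (wrap refl) next rewrite last-colour i = λ ()
  two-step-colour (wrap refl) (wrap ())

  -- Adjacency among labels below 12 does not depend on i, so this is decided by evaluation.  Every
  -- path of length at most two that uses a chord stays below 12 (chord-path-below-12).
  colour-proper-below-12 : ∀ {a b} → a < 12 → b < 12 → SqAdjBelow (polygonᵇ M gadget) 12 a b → colour a ≢ colour b
  colour-proper-below-12 a<12 b<12 = toWitness {a? = allUpTo? (λ a → allUpTo? (λ b →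
    sqAdjBelow? (polygonᵇ M gadget) 12 a b →-dec ¬? (colour a ≟ᶠ colour b)) 12) 12} _ a<12 b<12

  colour-path-below-12 : ∀ {a w b} → a ≢ b → T (polygonᵇ M gadget a w) → T (polygonᵇ M gadget w b) →
                 a < 12 × w < 12 × b < 12 → colour a ≢ colour b
  colour-path-below-12 a≢b aw wb (a<12 , w<12 , b<12) = colour-proper-below-12 a<12 b<12 (a≢b , inj₂ (_ , w<12 , aw , wb))

  gadget-neighbour-below-12 : ∀ {a b} → 1 ≤ a → a ≤ 10 → PolygonEdge M gadget a b → b < 12
  gadget-neighbour-below-12 _ a≤10 (forward next)     = s≤s (s≤s a≤10)
  gadget-neighbour-below-12 _ _    (forward (wrap _)) = s≤s z≤n
  gadget-neighbour-below-12 _ a≤10 (backward next)    = ≤-trans a≤10 (≤-trans (n≤1+n 10) (n≤1+n 11))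
  gadget-neighbour-below-12 () _ (backward (wrap _))
  gadget-neighbour-below-12 {a} {b} _ _ (chord c) = s≤s (m≤n⇒m≤1+n (proj₂ (proj₂ (gadget-endpoints {a} {b} c))))

  chord-path-below-12 : ∀ {a w b} → T (linkedᵇ gadget a w) → PolygonEdge M gadget w b → a < 12 × w < 12 × b < 12
  chord-path-below-12 aw wb with gadget-endpoints aw
  ... | (_ , a≤10) , (1≤w , w≤10) =
    s≤s (m≤n⇒m≤1+n a≤10) , s≤s (m≤n⇒m≤1+n w≤10) , gadget-neighbour-below-12 1≤w w≤10 wb

  colour-proper : ∀ u v → SqAdj (gadgetPolygon i) u v → colour (toℕ u) ≢ colour (toℕ v)
  colour-proper u v (u≢v , inj₁ uv) with polygon-edge {M} {gadget} {toℕ u} {toℕ v} uv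
  ... | forward s  = step-colour s
  ... | backward s = ≢-sym (step-colour s)
  ... | chord c with gadget-endpoints {toℕ u} {toℕ v} c
  ...   | (_ , u≤10) , (_ , v≤10) =
    colour-proper-below-12 (s≤s (m≤n⇒m≤1+n u≤10)) (s≤s (m≤n⇒m≤1+n v≤10)) (u≢v ∘ toℕ-injective , inj₁ uv)
  colour-proper u v (u≢v , inj₂ (w , uw , wv))
    with polygon-edge {M} {gadget} {toℕ u} {toℕ w} uw | polygon-edge {M} {gadget} {toℕ w} {toℕ v} wv
  ... | forward s  | forward t  = two-step-colour s t
  ... | backward s | backward t = ≢-sym (two-step-colour t s)
  ... | forward s  | backward t = ⊥-elim (u≢v (toℕ-injective (step-injective s t)))
  ... | backward s | forward t  = ⊥-elim (u≢v (toℕ-injective (step-functional (toℕ<n u) (toℕ<n v) s t)))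
  ... | chord c    | e          = colour-path-below-12 (u≢v ∘ toℕ-injective) uw wv (chord-path-below-12 c e)
  ... | e          | chord c    = colour-path-below-12 (u≢v ∘ toℕ-injective) uw wv
                                    (reverse (chord-path-below-12 (linked-sym gadget {toℕ w} {toℕ v} c) (polygon-edge-sym e)))
    where
    reverse : ∀ {A B C : Set} → A × B × C → C × B × A
    reverse (a , b , c) = c , b , a

  label<M : ∀ u → label u < M
  label<M u = <-≤-trans (toWitness {a? = allFin? λ u → label u <? 12} _ u) 12≤M

  embed : Fin 10 → Fin M
  embed u = fromℕ< (label<M u)

  obstruction-in-square : ∀ u v → T (obstruction u v) → SqAdjBelow (polygonᵇ M gadget) 12 (label u) (label v)
  obstruction-in-square = toWitness {a? = allFin? λ u → allFin? λ v →
    T? (obstruction u v) →-dec sqAdjBelow? (polygonᵇ M gadget) 12 (label u) (label v)} _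

  square-not-6-colourable : ¬ Colourable (SqAdj (gadgetPolygon i)) 6
  square-not-6-colourable =
    twoDiamonds-not-3-colourable ∘ colourable-uncone ∘ colourable-uncone ∘ colourable-uncone ∘
    colourable-comap embed λ u v uv →
      sqAdjBelow⇒SqAdj {cs = gadget} 12≤M (toℕ-fromℕ< (label<M u)) (toℕ-fromℕ< (label<M v))
                       (obstruction-in-square u v uv)

  square-chromatic : SqChromaticNumber (gadgetPolygon i) 7
  square-chromatic = ((λ u → colour (toℕ u)) , colour-proper) ,
                     λ j j<7 → square-not-6-colourable ∘ colourable-mono (s≤s⁻¹ j<7)

  degree-of-7 : degree (gadgetPolygon i) (# 7) ≡ 5
  degree-of-7 = ≡.trans (length-filterᵇ-tabulate (adj (gadgetPolygon i) (# 7)) id)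
                        (cong (5 +_) (count-none {i * 3} λ _ ()))

  max-degree : MaxDegree (gadgetPolygon i) 5
  max-degree = (λ v → ≤-trans (polygon-degree {M} {gadget} v) (s≤s (s≤s (gadget-partners (toℕ v))))) ,
               # 7 , degree-of-7

  biconnected : Biconnected (gadgetPolygon i)
  biconnected = label-cycle⇒biconnected _ (s≤s (s≤s (s≤s z≤n))) (polygon-label-cycle (s≤s (s≤s z≤n)))

theorem6p1 : Σ (ℕ → Graph) λ G →
    (∀ i → Biconnected (G i) × Outerplanar (G i) × MaxDegree (G i) 5 × SqChromaticNumber (G i) 7) ×
    (∀ i j → i ≢ j → ¬ Iso (G i) (G j))
theorem6p1 =
  gadgetPolygon ,
  (λ i → let open GadgetPolygon i in
         biconnected , polygon-outerplanar {M} {gadget} gadget-non-crossing , max-degree , square-chromatic) ,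
  λ i j i≢j iso → i≢j (order-injective (iso⇒same-order iso))
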